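{- Let $a,b$ be integers with $1 \le a < b$. If $B$ is a basis of a matroid $M$ with $r(M) > a$ and $\tau_a(M) \ge \binom{b}{a}^{r(M)-a}$, then $M$ has a $U_{a+1,b}$-minor $U$ in which $E(U) \cap B$ is a basis of $U$.
   Context: For an integer $a \ge 1$, the $a$-covering number $\tau_a(M)$ is the minimum number of sets of rank at most $a$ in $M$ needed to cover $E(M)$. -}

module Defs where

open import Data.Nat using (ℕ; suc; _+_; _≤_; _⊓_)
open import Data.Fin using (Fin)
open import Data.Fin.Subset using (Subset; _∈_; _⊆_; _∪_; _∩_; ∁; ∣_∣; ⊤; ⊥)
open import Data.List using (List; length)
open import Data.List.Relation.Unary.All using (All)
open import Data.List.Membership.Propositional using () renaming (_∈_ to _∈ˡ_)
open import Data.Product using (Σ; _×_; ∃-syntax)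
open import Relation.Binary.PropositionalEquality using (_≡_)

record Matroid (n : ℕ) : Set where
  field
    r      : Subset n → ℕ
    r-bnd  : ∀ X → r X ≤ ∣ X ∣
    r-mono : ∀ {X Y} → X ⊆ Y → r X ≤ r Y
    r-sub  : ∀ X Y → r (X ∪ Y) + r (X ∩ Y) ≤ r X + r Y

open Matroid public

rankM : ∀ {n} → Matroid n → ℕ
rankM M = r M ⊤

IsBasis : ∀ {n} → Matroid n → Subset n → Set
IsBasis M B = (r M B ≡ ∣ B ∣) × (r M B ≡ rankM M)

HasCover : ∀ {n} → Matroid n → ℕ → ℕ → Set
HasCover {n} M a k =
  Σ (List (Subset n)) λ Xs →
    (length Xs ≡ k) × All (λ X → r M X ≤ a) Xs ×
    (∀ (e : Fin n) → ∃[ X ] ((X ∈ˡ Xs) × (e ∈ X)))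

IsTau : ∀ {n} → Matroid n → ℕ → ℕ → Set
IsTau M a t = HasCover M a t × (∀ k → HasCover M a k → t ≤ k)

-- The minor M / C \ D (C, D disjoint) has ground set E − (C ∪ D) and
-- rank function X ↦ r(X ∪ C) − r(C).
minorGround : ∀ {n} → Subset n → Subset n → Subset n
minorGround C D = ∁ (C ∪ D)

minorRank : ∀ {n} → Matroid n → Subset n → Subset n → ℕ
minorRank M C X = r M (X ∪ C) Data.Nat.∸ r M C

Disjoint : ∀ {n} → Subset n → Subset n → Set
Disjoint C D = C ∩ D ≡ ⊥

IsUniformMinor : ∀ {n} → Matroid n → Subset n → Subset n → ℕ → ℕ → Set
IsUniformMinor M C D k m =
  Disjoint C D × (∣ minorGround C D ∣ ≡ m) ×
  (∀ X → X ⊆ minorGround C D → minorRank M C X ≡ k ⊓ ∣ X ∣)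

IsMinorBasis : ∀ {n} → Matroid n → Subset n → Subset n → Subset n → Set
IsMinorBasis M C D Y =
  (Y ⊆ minorGround C D) × (minorRank M C Y ≡ ∣ Y ∣) ×
  (minorRank M C Y ≡ minorRank M C (minorGround C D))

module Submission where

-- Put D = (b - 1) C a, which is smaller than b C a.  Say G has
-- rank ≤ s over K when r(G ∪ K) ≤ s + r(K), i.e. G has rank ≤ s in M / K.
-- Key step: for K ⊆ B and F of rank a + 1 over K, extend K greedily inside B
-- to K′ with F ∪ K′ spanning M.  Then S = B - K′ has a + 1 points, and we
-- grow S greedily, keeping it uniform of rank a + 1 in M / K′, by points
-- spanned by K′ with no a-subset.  If it reaches b points it is the minor;
-- otherwise every point lies in cl(A ∪ K′) for an a-subset A, and the at
-- most D sets F ∩ cl(A ∪ K′) have rank ≤ a over K, by submodularity.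
-- Applying this along a chain of independent sets K ⊆ B covers E(M) by
-- D^(r(M) - a) sets of rank ≤ a unless the minor exists; as D < b C a this
-- contradicts the bound on τ_a(M).

open import Defs
open import Data.Nat.Base using (>-nonZero)
open import Data.Nat using (ℕ; zero; suc; pred; _+_; _*_; _^_; _∸_; _⊓_; _≤_; _<_; _≤′_; ≤′-refl; ≤′-step; _≤?_; z≤n; s≤s)
open import Data.Nat.Properties
open import Algebra.Properties.CommutativeSemigroup +-commutativeSemigroup using (x∙yz≈y∙xz; xy∙z≈zx∙y)
open import Data.Nat.Combinatorics using (_C_; nCk+nC[k+1]≡[n+1]C[k+1])
open import Data.Fin using (Fin)
open import Data.Fin.Properties using (any?)
open import Data.Fin.Subset using (Subset; _∈_; _∉_; _⊆_; _∪_; _∩_; ∁; ∣_∣; ⁅_⁆; ⊤; ⊥; inside; outside)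
open import Data.Fin.Subset.Properties
open import Data.Vec using ([]; _∷_; here; there; tabulate)
open import Data.Vec.Properties using (lookup∘tabulate; []=⇒lookup; lookup⇒[]=)
open import Data.Bool using (true)
open import Data.List using (List; []; _∷_; map; _++_; length; allFin; foldr; filter)
open import Data.List.Properties using (length-map; length-++)
open import Data.List.Membership.Propositional using (find) renaming (_∈_ to _∈ˡ_)
open import Data.List.Membership.Propositional.Properties
  using (∈-map⁺; ∈-map⁻; ∈-++⁺ˡ; ∈-++⁺ʳ; ∈-++⁻; ∈-allFin; ∈-filter⁺; ∈-filter⁻)
open import Data.List.Relation.Unary.All as All using (All; []; _∷_)
open import Data.List.Relation.Unary.All.Properties using (¬All⇒Any¬; ++⁺; map⁺)
open import Data.List.Relation.Unary.Any using (here; there)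
open import Data.Product using (_×_; _,_; proj₁; proj₂; ∃-syntax)
open import Data.Sum using (_⊎_; inj₁; inj₂; [_,_]′)
open import Data.Empty using (⊥-elim)
open import Relation.Nullary using (¬_; Dec; yes; no; does)
open import Relation.Nullary.Decidable using (_×-dec_; ¬?; decidable-stable; dec-true)
open import Relation.Binary.PropositionalEquality
  using (_≡_; refl; sym; trans; cong; cong₂; subst; module ≡-Reasoning)

private variable
  n : ℕ
  p q s : Subset n

∪-lub : p ⊆ s → q ⊆ s → p ∪ q ⊆ s
∪-lub {p = p} {q = q} p⊆s q⊆s x∈p∪q with x∈p∪q⁻ p q x∈p∪q
... | inj₁ x∈p = p⊆s x∈p
... | inj₂ x∈q = q⊆s x∈q

∪-mono : ∀ {p′ q′ : Subset n} → p ⊆ p′ → q ⊆ q′ → p ∪ q ⊆ p′ ∪ q′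
∪-mono {p′ = p′} {q′} p⊆p′ q⊆q′ =
  ∪-lub (λ x∈ → p⊆p∪q q′ (p⊆p′ x∈)) (λ x∈ → q⊆p∪q p′ q′ (q⊆q′ x∈))

∩-glb : s ⊆ p → s ⊆ q → s ⊆ p ∩ q
∩-glb s⊆p s⊆q x∈s = x∈p∩q⁺ (s⊆p x∈s , s⊆q x∈s)

∉-∪ : ∀ {x : Fin n} → x ∉ p → x ∉ q → x ∉ p ∪ q
∉-∪ {p = p} {q} x∉p x∉q x∈p∪q with x∈p∪q⁻ p q x∈p∪q
... | inj₁ x∈p = x∉p x∈p
... | inj₂ x∈q = x∉q x∈q

⁅⁆⊆ : ∀ {x : Fin n} → x ∈ p → ⁅ x ⁆ ⊆ p
⁅⁆⊆ {p = p} {x} x∈p y∈⁅x⁆ = subst (_∈ p) (sym (x∈⁅y⁆⇒x≡y x y∈⁅x⁆)) x∈p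

∉⇒⊆∁⁅⁆ : ∀ {y : Fin n} → y ∉ p → p ⊆ ∁ ⁅ y ⁆
∉⇒⊆∁⁅⁆ {p = p} {y} y∉p x∈p =
  x∉p⇒x∈∁p (λ x∈⁅y⁆ → y∉p (subst (_∈ p) (x∈⁅y⁆⇒x≡y y x∈⁅y⁆) x∈p))

⊆∪⁅⁆-avoiding : ∀ {y : Fin n} → s ⊆ p ∪ ⁅ y ⁆ → s ⊆ ∁ ⁅ y ⁆ → s ⊆ p
⊆∪⁅⁆-avoiding {p = p} {y} s⊆p∪y s⊆∁y x∈s with x∈p∪q⁻ p ⁅ y ⁆ (s⊆p∪y x∈s)
... | inj₁ x∈p = x∈p
... | inj₂ x∈⁅y⁆ = ⊥-elim (x∈∁p⇒x∉p (s⊆∁y x∈s) x∈⁅y⁆)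

∪-swapʳ : (p q s : Subset n) → (p ∪ q) ∪ s ≡ (p ∪ s) ∪ q
∪-swapʳ p q s = begin
  (p ∪ q) ∪ s ≡⟨ ∪-assoc p q s ⟩
  p ∪ (q ∪ s) ≡⟨ cong (p ∪_) (∪-comm q s) ⟩
  p ∪ (s ∪ q) ≡⟨ ∪-assoc p s q ⟨
  (p ∪ s) ∪ q ∎
  where open ≡-Reasoning

∣∪∣-disjoint : (p q : Subset n) → p ⊆ ∁ q → ∣ p ∪ q ∣ ≡ ∣ p ∣ + ∣ q ∣
∣∪∣-disjoint [] [] _ = refl
∣∪∣-disjoint (inside ∷ p) (inside ∷ q) p⊆∁q with p⊆∁q here
... | ()
∣∪∣-disjoint (inside ∷ p) (outside ∷ q) p⊆∁q = cong suc (∣∪∣-disjoint p q (drop-∷-⊆ p⊆∁q))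
∣∪∣-disjoint (outside ∷ p) (inside ∷ q) p⊆∁q =
  trans (cong suc (∣∪∣-disjoint p q (drop-∷-⊆ p⊆∁q))) (sym (+-suc ∣ p ∣ ∣ q ∣))
∣∪∣-disjoint (outside ∷ p) (outside ∷ q) p⊆∁q = ∣∪∣-disjoint p q (drop-∷-⊆ p⊆∁q)

⊆∖∪ : (p q : Subset n) → p ⊆ (p ∩ ∁ q) ∪ q
⊆∖∪ p q {x} x∈p with x ∈? q
... | yes x∈q = q⊆p∪q (p ∩ ∁ q) q x∈q
... | no  x∉q = p⊆p∪q q (x∈p∩q⁺ (x∈p , x∉p⇒x∈∁p x∉q))

∖∪-split : q ⊆ p → (p ∩ ∁ q) ∪ q ≡ p
∖∪-split {q = q} {p = p} q⊆p = ⊆-antisym (∪-lub (p∩q⊆p p (∁ q)) q⊆p) (⊆∖∪ p q)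

∣∣-split : q ⊆ p → ∣ p ∣ ≡ ∣ p ∩ ∁ q ∣ + ∣ q ∣
∣∣-split {q = q} {p = p} q⊆p =
  trans (cong ∣_∣ (sym (∖∪-split q⊆p))) (∣∪∣-disjoint (p ∩ ∁ q) q (p∩q⊆q p (∁ q)))

∣∪⁅⁆∣ : ∀ {y : Fin n} → y ∉ p → ∣ p ∪ ⁅ y ⁆ ∣ ≡ suc ∣ p ∣
∣∪⁅⁆∣ {p = p} {y} y∉p = begin
  ∣ p ∪ ⁅ y ⁆ ∣     ≡⟨ ∣∪∣-disjoint p ⁅ y ⁆ (∉⇒⊆∁⁅⁆ y∉p) ⟩
  ∣ p ∣ + ∣ ⁅ y ⁆ ∣ ≡⟨ cong (∣ p ∣ +_) (∣⁅x⁆∣≡1 y) ⟩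
  ∣ p ∣ + 1         ≡⟨ +-comm ∣ p ∣ 1 ⟩
  suc ∣ p ∣         ∎
  where open ≡-Reasoning

interpolate : (Y X : Subset n) (k : ℕ) → Y ⊆ X → ∣ Y ∣ ≤ k → k ≤ ∣ X ∣ →
              ∃[ A ] (Y ⊆ A × A ⊆ X × ∣ A ∣ ≡ k)
interpolate [] [] zero _ _ _ = [] , ⊆-refl , ⊆-refl , refl
interpolate (inside ∷ Y) (outside ∷ X) k Y⊆X _ _ with Y⊆X here
... | ()
interpolate (outside ∷ Y) (outside ∷ X) k Y⊆X Y≤k k≤X
  with interpolate Y X k (drop-∷-⊆ Y⊆X) Y≤k k≤X
... | A , Y⊆A , A⊆X , ∣A∣ = outside ∷ A , s⊆s Y⊆A , out⊆ A⊆X , ∣A∣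
interpolate (inside ∷ Y) (inside ∷ X) (suc k) Y⊆X (s≤s Y≤k) (s≤s k≤X)
  with interpolate Y X k (drop-∷-⊆ Y⊆X) Y≤k k≤X
... | A , Y⊆A , A⊆X , ∣A∣ = inside ∷ A , s⊆s Y⊆A , s⊆s A⊆X , cong suc ∣A∣
interpolate (outside ∷ Y) (inside ∷ X) k Y⊆X Y≤k k≤1+X with k ≤? ∣ X ∣
... | yes k≤X with interpolate Y X k (drop-∷-⊆ Y⊆X) Y≤k k≤X
...   | A , Y⊆A , A⊆X , ∣A∣ = outside ∷ A , s⊆s Y⊆A , out⊆ A⊆X , ∣A∣
interpolate (outside ∷ Y) (inside ∷ X) zero Y⊆X Y≤k k≤1+X | no k≰X = ⊥-elim (k≰X z≤n)
interpolate (outside ∷ Y) (inside ∷ X) (suc k) Y⊆X Y≤k (s≤s k≤X) | no k≰X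
  with interpolate Y X k (drop-∷-⊆ Y⊆X) (≤-trans (p⊆q⇒∣p∣≤∣q∣ (drop-∷-⊆ Y⊆X)) (≤-pred (≰⇒> k≰X))) k≤X
... | A , Y⊆A , A⊆X , ∣A∣ = inside ∷ A , out⊆ Y⊆A , s⊆s A⊆X , cong suc ∣A∣

-- The list of all k-element subsets of X (the clauses split on X first, so
-- that the outside-case computes for every k).
subsetsOfSize : ℕ → Subset n → List (Subset n)
subsetsOfSize k       (outside ∷ X) = map (outside ∷_) (subsetsOfSize k X)
subsetsOfSize zero    []            = [] ∷ []
subsetsOfSize (suc k) []            = []
subsetsOfSize zero    (inside ∷ X)  = map (outside ∷_) (subsetsOfSize zero X)
subsetsOfSize (suc k) (inside ∷ X)  =
  map (inside ∷_) (subsetsOfSize k X) ++ map (outside ∷_) (subsetsOfSize (suc k) X)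

length-subsetsOfSize : (k : ℕ) (X : Subset n) → length (subsetsOfSize k X) ≡ ∣ X ∣ C k
length-subsetsOfSize zero    []            = refl
length-subsetsOfSize (suc k) []            = refl
length-subsetsOfSize k       (outside ∷ X) =
  trans (length-map _ (subsetsOfSize k X)) (length-subsetsOfSize k X)
length-subsetsOfSize zero    (inside ∷ X)  =
  trans (length-map _ (subsetsOfSize zero X)) (length-subsetsOfSize zero X)
length-subsetsOfSize (suc k) (inside ∷ X)  = begin
  length (map (inside ∷_) (subsetsOfSize k X) ++ map (outside ∷_) (subsetsOfSize (suc k) X))
    ≡⟨ length-++ (map (inside ∷_) (subsetsOfSize k X)) ⟩
  length (map (inside ∷_) (subsetsOfSize k X)) + length (map (outside ∷_) (subsetsOfSize (suc k) X))
    ≡⟨ cong₂ _+_ (length-map _ (subsetsOfSize k X)) (length-map _ (subsetsOfSize (suc k) X)) ⟩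
  length (subsetsOfSize k X) + length (subsetsOfSize (suc k) X)
    ≡⟨ cong₂ _+_ (length-subsetsOfSize k X) (length-subsetsOfSize (suc k) X) ⟩
  ∣ X ∣ C k + ∣ X ∣ C suc k
    ≡⟨ nCk+nC[k+1]≡[n+1]C[k+1] ∣ X ∣ k ⟩
  suc ∣ X ∣ C suc k ∎
  where open ≡-Reasoning

subsetsOfSize-sound : (k : ℕ) (X : Subset n) {A : Subset n} →
                      A ∈ˡ subsetsOfSize k X → A ⊆ X × ∣ A ∣ ≡ k
subsetsOfSize-sound zero [] (here refl) = ⊆-refl , refl
subsetsOfSize-sound k (outside ∷ X) A∈ with ∈-map⁻ (outside ∷_) A∈
... | A , A∈′ , refl with subsetsOfSize-sound k X A∈′
...   | A⊆X , ∣A∣ = s⊆s A⊆X , ∣A∣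
subsetsOfSize-sound zero (inside ∷ X) A∈ with ∈-map⁻ (outside ∷_) A∈
... | A , A∈′ , refl with subsetsOfSize-sound zero X A∈′
...   | A⊆X , ∣A∣ = out⊆ A⊆X , ∣A∣
subsetsOfSize-sound (suc k) (inside ∷ X) A∈ with ∈-++⁻ (map (inside ∷_) (subsetsOfSize k X)) A∈
... | inj₁ A∈ˡ with ∈-map⁻ (inside ∷_) A∈ˡ
...   | A , A∈′ , refl with subsetsOfSize-sound k X A∈′
...     | A⊆X , ∣A∣ = s⊆s A⊆X , cong suc ∣A∣
subsetsOfSize-sound (suc k) (inside ∷ X) A∈ | inj₂ A∈ʳ with ∈-map⁻ (outside ∷_) A∈ʳ
...   | A , A∈′ , refl with subsetsOfSize-sound (suc k) X A∈′
...     | A⊆X , ∣A∣ = out⊆ A⊆X , ∣A∣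

subsetsOfSize-complete : (k : ℕ) (X A : Subset n) → A ⊆ X → ∣ A ∣ ≡ k → A ∈ˡ subsetsOfSize k X
subsetsOfSize-complete zero [] [] _ _ = here refl
subsetsOfSize-complete k (outside ∷ X) (inside ∷ A) A⊆X _ with A⊆X here
... | ()
subsetsOfSize-complete k (outside ∷ X) (outside ∷ A) A⊆X ∣A∣ =
  ∈-map⁺ _ (subsetsOfSize-complete k X A (drop-∷-⊆ A⊆X) ∣A∣)
subsetsOfSize-complete zero (inside ∷ X) (outside ∷ A) A⊆X ∣A∣ =
  ∈-map⁺ _ (subsetsOfSize-complete zero X A (drop-∷-⊆ A⊆X) ∣A∣)
subsetsOfSize-complete (suc k) (inside ∷ X) (inside ∷ A) A⊆X ∣A∣ =
  ∈-++⁺ˡ (∈-map⁺ _ (subsetsOfSize-complete k X A (drop-∷-⊆ A⊆X) (suc-injective ∣A∣)))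
subsetsOfSize-complete (suc k) (inside ∷ X) (outside ∷ A) A⊆X ∣A∣ =
  ∈-++⁺ʳ (map (inside ∷_) (subsetsOfSize k X))
         (∈-map⁺ _ (subsetsOfSize-complete (suc k) X A (drop-∷-⊆ A⊆X) ∣A∣))

C-pos : ∀ {m k} → k ≤ m → 0 < m C k
C-pos {k = zero} _ = s≤s z≤n
C-pos {suc m} {suc k} (s≤s k≤m) =
  subst (0 <_) (nCk+nC[k+1]≡[n+1]C[k+1] m k) (≤-trans (C-pos k≤m) (m≤m+n (m C k) (m C suc k)))

C-suc : ∀ m k → m C k ≤ suc m C k
C-suc m zero    = ≤-refl
C-suc m (suc k) = subst (m C suc k ≤_) (nCk+nC[k+1]≡[n+1]C[k+1] m k) (m≤n+m (m C suc k) (m C k))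

C-monoˡ : ∀ k {l m} → l ≤ m → l C k ≤ m C k
C-monoˡ k l≤m = go (≤⇒≤′ l≤m)
  where
  go : ∀ {l m} → l ≤′ m → l C k ≤ m C k
  go ≤′-refl       = ≤-refl
  go (≤′-step l≤m) = ≤-trans (go l≤m) (C-suc _ k)

C-pred< : ∀ {a b} → 1 ≤ a → a < b → pred b C a < b C a
C-pred< {suc a} {suc b} _ (s≤s a<b) =
  subst (b C suc a <_) (nCk+nC[k+1]≡[n+1]C[k+1] b a)
        (m<n+m (b C suc a) (C-pos (≤-trans (n≤1+n a) a<b)))

module Greedy {n : ℕ} (Q : Subset n → Fin n → Set) (Q? : ∀ X y → Dec (Q X y)) where

  step : Subset n → Fin n → Subset n
  step X y with Q? X y
  ... | yes _ = X ∪ ⁅ y ⁆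
  ... | no  _ = X

  run : List (Fin n) → Subset n → Subset n
  run []       X = X
  run (y ∷ ys) X = run ys (step X y)

  scan : Subset n → Subset n
  scan = run (allFin n)

  step-⊇ : ∀ X y → X ⊆ step X y
  step-⊇ X y with Q? X y
  ... | yes _ = p⊆p∪q ⁅ y ⁆
  ... | no  _ = ⊆-refl

  run-⊇ : ∀ ys X → X ⊆ run ys X
  run-⊇ []       X    = ⊆-refl
  run-⊇ (y ∷ ys) X x∈ = run-⊇ ys (step X y) (step-⊇ X y x∈)

  scan-⊇ : ∀ X → X ⊆ scan X
  scan-⊇ = run-⊇ (allFin n)

  module _ (Inv : Subset n → Set)
           (preserve : ∀ X y → Inv X → Q X y → Inv (X ∪ ⁅ y ⁆)) where

    step-inv : ∀ X y → Inv X → Inv (step X y)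
    step-inv X y inv with Q? X y
    ... | yes q = preserve X y inv q
    ... | no  _ = inv

    run-inv : ∀ ys X → Inv X → Inv (run ys X)
    run-inv []       X inv = inv
    run-inv (y ∷ ys) X inv = run-inv ys (step X y) (step-inv X y inv)

    scan-inv : ∀ X → Inv X → Inv (scan X)
    scan-inv = run-inv (allFin n)

  run-maximal : ∀ ys X {y} → y ∈ˡ ys → y ∈ run ys X ⊎ ∃[ X′ ] (X′ ⊆ run ys X × ¬ Q X′ y)
  run-maximal (y ∷ ys) X (here refl) with Q? X y
  ... | yes _  = inj₁ (run-⊇ ys (X ∪ ⁅ y ⁆) (q⊆p∪q X ⁅ y ⁆ (x∈⁅x⁆ y)))
  ... | no  ¬q = inj₂ (X , run-⊇ ys X , ¬q)
  run-maximal (z ∷ ys) X (there y∈ys) = run-maximal ys (step X z) y∈ys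

  scan-maximal : ∀ X y → y ∈ scan X ⊎ ∃[ X′ ] (X′ ⊆ scan X × ¬ Q X′ y)
  scan-maximal X y = run-maximal (allFin n) X (∈-allFin y)

-- Arithmetic heart of uniform-insert below: u = c + min(a+1, m) is the rank
-- of Y′ ∪ K, and v the rank after adding one point.
uniform-step : ∀ a c m {u v} → u ≡ c + suc a ⊓ m → u ≤ v → v ≤ suc u → v ≤ c + suc a →
               (m ≤ a → u < v) → v ≡ c + suc a ⊓ suc m
uniform-step a c m {u} {v} u≡ u≤v v≤1+u v≤c+1+a grows with m ≤? a
... | yes m≤a = begin
  v                   ≡⟨ ≤-antisym v≤1+u (grows m≤a) ⟩
  suc u               ≡⟨ cong suc u≡ ⟩
  suc (c + suc a ⊓ m) ≡⟨ cong (λ t → suc (c + t)) (m≥n⇒m⊓n≡n (m≤n⇒m≤1+n m≤a)) ⟩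
  suc (c + m)         ≡⟨ +-suc c m ⟨
  c + suc m           ≡⟨ cong (c +_) (m≥n⇒m⊓n≡n (s≤s m≤a)) ⟨
  c + suc a ⊓ suc m   ∎
  where open ≡-Reasoning
... | no m≰a = begin
  v                   ≡⟨ ≤-antisym v≤c+1+a c+1+a≤v ⟩
  c + suc a           ≡⟨ cong (c +_) (m≤n⇒m⊓n≡m (m≤n⇒m≤1+n a<m)) ⟨
  c + suc a ⊓ suc m   ∎
  where
  open ≡-Reasoning
  a<m : suc a ≤ m
  a<m = ≰⇒> m≰a
  c+1+a≤v : c + suc a ≤ v
  c+1+a≤v = ≤-trans (≤-reflexive (trans (cong (c +_) (sym (m≤n⇒m⊓n≡m a<m))) (sym u≡))) u≤v

does-true : ∀ {P : Set} (P? : Dec P) → does P? ≡ true → P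
does-true (yes p) _  = p
does-true (no _)  ()

module Rank {n : ℕ} (M : Matroid n) where

  rk : Subset n → ℕ
  rk = r M

  ρ : ℕ
  ρ = rankM M

  rk-≤ρ : ∀ X → rk X ≤ ρ
  rk-≤ρ X = r-mono M ⊆⊤

  rk-⊥ : rk ⊥ ≡ 0
  rk-⊥ = n≤0⇒n≡0 (≤-trans (r-bnd M ⊥) (≤-reflexive (∣⊥∣≡0 n)))

  submodular-⊆ : ∀ {P Q} X Y → P ⊆ X ∪ Y → Q ⊆ X ∩ Y → rk P + rk Q ≤ rk X + rk Y
  submodular-⊆ X Y P⊆ Q⊆ = ≤-trans (+-mono-≤ (r-mono M P⊆) (r-mono M Q⊆)) (r-sub M X Y)

  subadditive : ∀ X Y → rk (X ∪ Y) ≤ rk X + rk Y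
  subadditive X Y = ≤-trans (m≤m+n (rk (X ∪ Y)) (rk ⊥)) (submodular-⊆ X Y ⊆-refl ⊥⊆)

  rk-∪⁅⁆ : ∀ Z y → rk (Z ∪ ⁅ y ⁆) ≤ suc (rk Z)
  rk-∪⁅⁆ Z y = begin
    rk (Z ∪ ⁅ y ⁆)  ≤⟨ subadditive Z ⁅ y ⁆ ⟩
    rk Z + rk ⁅ y ⁆ ≤⟨ +-monoʳ-≤ (rk Z) (≤-trans (r-bnd M ⁅ y ⁆) (≤-reflexive (∣⁅x⁆∣≡1 y))) ⟩
    rk Z + 1        ≡⟨ +-comm (rk Z) 1 ⟩
    suc (rk Z)      ∎
    where open ≤-Reasoning

  independent-⊆ : ∀ {I X} → rk I ≡ ∣ I ∣ → X ⊆ I → rk X ≡ ∣ X ∣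
  independent-⊆ {I} {X} I-indep X⊆I = ≤-antisym (r-bnd M X) (+-cancelˡ-≤ ∣ I ∩ ∁ X ∣ ∣ X ∣ (rk X) (begin
    ∣ I ∩ ∁ X ∣ + ∣ X ∣   ≡⟨ ∣∣-split X⊆I ⟨
    ∣ I ∣                 ≡⟨ I-indep ⟨
    rk I                  ≤⟨ r-mono M (⊆∖∪ I X) ⟩
    rk ((I ∩ ∁ X) ∪ X)    ≤⟨ subadditive (I ∩ ∁ X) X ⟩
    rk (I ∩ ∁ X) + rk X   ≤⟨ +-monoˡ-≤ (rk X) (r-bnd M (I ∩ ∁ X)) ⟩
    ∣ I ∩ ∁ X ∣ + rk X    ∎))
    where open ≤-Reasoning

  Spans : Subset n → Fin n → Set
  Spans Z y = rk (Z ∪ ⁅ y ⁆) ≤ rk Z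

  spans? : ∀ Z y → Dec (Spans Z y)
  spans? Z y = rk (Z ∪ ⁅ y ⁆) ≤? rk Z

  spans-member : ∀ {Z y} → y ∈ Z → Spans Z y
  spans-member y∈Z = r-mono M (∪-lub ⊆-refl (⁅⁆⊆ y∈Z))

  -- Closure is monotone; this is submodularity for Z and Y ∪ ⁅ y ⁆.
  spans-mono : ∀ {Y Z y} → Y ⊆ Z → Spans Y y → Spans Z y
  spans-mono {Y} {Z} {y} Y⊆Z Y-spans = +-cancelʳ-≤ (rk Y) (rk (Z ∪ ⁅ y ⁆)) (rk Z) (begin
    rk (Z ∪ ⁅ y ⁆) + rk Y  ≤⟨ submodular-⊆ Z (Y ∪ ⁅ y ⁆) (∪-mono ⊆-refl (q⊆p∪q Y ⁅ y ⁆))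
                                                      (∩-glb Y⊆Z (p⊆p∪q ⁅ y ⁆)) ⟩
    rk Z + rk (Y ∪ ⁅ y ⁆)  ≤⟨ +-monoʳ-≤ (rk Z) Y-spans ⟩
    rk Z + rk Y            ∎)
    where open ≤-Reasoning

  -- The set of points of a list; spans-set decomposes W into such points.
  points : List (Fin n) → Subset n
  points = foldr (λ y S → ⁅ y ⁆ ∪ S) ⊥

  ∈-points : ∀ {y ys} → y ∈ˡ ys → y ∈ points ys
  ∈-points {y} (here refl) = p⊆p∪q _ (x∈⁅x⁆ y)
  ∈-points {ys = z ∷ ys} (there y∈ys) = q⊆p∪q ⁅ z ⁆ (points ys) (∈-points y∈ys)

  spans-points : ∀ Z ys → All (Spans Z) ys → rk (Z ∪ points ys) ≤ rk Z
  spans-points Z [] [] = r-mono M (∪-lub ⊆-refl ⊥⊆)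
  spans-points Z (y ∷ ys) (y-spanned ∷ spanned) = begin
    rk (Z ∪ (⁅ y ⁆ ∪ points ys)) ≡⟨ cong rk (trans (sym (∪-assoc Z ⁅ y ⁆ (points ys)))
                                                  (∪-swapʳ Z ⁅ y ⁆ (points ys))) ⟩
    rk ((Z ∪ points ys) ∪ ⁅ y ⁆) ≤⟨ spans-mono (p⊆p∪q (points ys)) y-spanned ⟩
    rk (Z ∪ points ys)           ≤⟨ spans-points Z ys spanned ⟩
    rk Z                         ∎
    where open ≤-Reasoning

  spans-set : ∀ Z W → (∀ {y} → y ∈ W → Spans Z y) → rk (Z ∪ W) ≤ rk Z
  spans-set Z W W-spanned = ≤-trans (r-mono M (∪-mono ⊆-refl W⊆)) (spans-points Z ys ys-spanned)
    where
    ys = filter (_∈? W) (allFin n)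
    W⊆ : W ⊆ points ys
    W⊆ y∈W = ∈-points (∈-filter⁺ (_∈? W) (∈-allFin _) y∈W)
    ys-spanned : All (Spans Z) ys
    ys-spanned = All.tabulate (λ y∈ys → W-spanned (proj₂ (∈-filter⁻ (_∈? W) {xs = allFin n} y∈ys)))

  closure : Subset n → Subset n
  closure Z = tabulate (λ y → does (spans? Z y))

  ∈closure⁺ : ∀ {Z y} → Spans Z y → y ∈ closure Z
  ∈closure⁺ {Z} {y} Z-spans =
    lookup⇒[]= y (closure Z) (trans (lookup∘tabulate _ y) (dec-true (spans? Z y) Z-spans))

  ∈closure⁻ : ∀ {Z y} → y ∈ closure Z → Spans Z y
  ∈closure⁻ {Z} {y} y∈ = does-true (spans? Z y) (trans (sym (lookup∘tabulate _ y)) ([]=⇒lookup y∈))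

  Uniform : ℕ → Subset n → Subset n → Set
  Uniform k K X = ∀ Y → Y ⊆ X → rk (Y ∪ K) ≡ rk K + k ⊓ ∣ Y ∣

  uniform-insert : ∀ {a K X y} → ρ ≤ rk K + suc a → a ≤ ∣ X ∣ → Uniform (suc a) K X →
                   (∀ A → A ⊆ X → ∣ A ∣ ≡ a → ¬ Spans (A ∪ K) y) →
                   Uniform (suc a) K (X ∪ ⁅ y ⁆)
  uniform-insert {a} {K} {X} {y} ρ≤ a≤∣X∣ X-unif y-free Y Y⊆ with y ∈? Y
  ... | no  y∉Y = X-unif Y (⊆∪⁅⁆-avoiding Y⊆ (∉⇒⊆∁⁅⁆ y∉Y))
  ... | yes y∈Y = begin
    rk (Y ∪ K)                 ≡⟨ cong rk Y∪K≡ ⟩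
    rk ((Y′ ∪ K) ∪ ⁅ y ⁆)       ≡⟨ uniform-step a (rk K) ∣ Y′ ∣ (X-unif Y′ Y′⊆X) (r-mono M (p⊆p∪q ⁅ y ⁆))
                                     (rk-∪⁅⁆ (Y′ ∪ K) y) (≤-trans (rk-≤ρ _) ρ≤) grows ⟩
    rk K + suc a ⊓ suc ∣ Y′ ∣  ≡⟨ cong (λ m → rk K + suc a ⊓ m) ∣Y∣ ⟨
    rk K + suc a ⊓ ∣ Y ∣       ∎
    where
    open ≡-Reasoning
    Y′ = Y ∩ ∁ ⁅ y ⁆
    Y′⊆X : Y′ ⊆ X
    Y′⊆X = ⊆∪⁅⁆-avoiding (λ x∈ → Y⊆ (p∩q⊆p Y (∁ ⁅ y ⁆) x∈)) (p∩q⊆q Y (∁ ⁅ y ⁆))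
    Y′∪y≡Y : Y′ ∪ ⁅ y ⁆ ≡ Y
    Y′∪y≡Y = ∖∪-split (⁅⁆⊆ y∈Y)
    ∣Y∣ : ∣ Y ∣ ≡ suc ∣ Y′ ∣
    ∣Y∣ = trans (cong ∣_∣ (sym Y′∪y≡Y))
                (∣∪⁅⁆∣ (λ y∈Y′ → x∈∁p⇒x∉p (p∩q⊆q Y (∁ ⁅ y ⁆) y∈Y′) (x∈⁅x⁆ y)))
    Y∪K≡ : Y ∪ K ≡ (Y′ ∪ K) ∪ ⁅ y ⁆
    Y∪K≡ = trans (cong (_∪ K) (sym Y′∪y≡Y)) (∪-swapʳ Y′ ⁅ y ⁆ K)
    grows : ∣ Y′ ∣ ≤ a → rk (Y′ ∪ K) < rk ((Y′ ∪ K) ∪ ⁅ y ⁆)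
    grows ∣Y′∣≤a with interpolate Y′ X a Y′⊆X ∣Y′∣≤a a≤∣X∣
    ... | A , Y′⊆A , A⊆X , ∣A∣ =
      ≰⇒> (λ Y′∪K-spans → y-free A A⊆X ∣A∣ (spans-mono (∪-mono Y′⊆A ⊆-refl) Y′∪K-spans))

Covers : List (Subset n) → Subset n → Set
Covers Gs F = ∀ {y} → y ∈ F → ∃[ G ] (G ∈ˡ Gs × y ∈ G)

covers-++ˡ : ∀ {Gs} Hs → Covers Gs s → Covers (Gs ++ Hs) s
covers-++ˡ Hs covers y∈ with covers y∈
... | G , G∈ , y∈G = G , ∈-++⁺ˡ G∈ , y∈G

covers-++ʳ : ∀ Gs {Hs} → Covers Hs s → Covers (Gs ++ Hs) s
covers-++ʳ Gs covers y∈ with covers y∈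
... | G , G∈ , y∈G = G , ∈-++⁺ʳ Gs G∈ , y∈G

module Covering {n : ℕ} (M : Matroid n) (B : Subset n) (B-basis : IsBasis M B)
                (a b : ℕ) (1≤a : 1 ≤ a) (a<b : a < b) where

  open Rank M

  BasisUniformMinor : Set
  BasisUniformMinor = ∃[ K ] ∃[ L ] (IsUniformMinor M K L (suc a) b ×
                                     IsMinorBasis M K L (minorGround K L ∩ B))

  -- The number of pieces into which one set of rank a + 1 is refined.
  D : ℕ
  D = pred b C a

  D-pos : 0 < D
  D-pos = C-pos (suc[m]≤n⇒m≤pred[n] a<b)

  Bounded : Subset n → ℕ → Subset n → Set
  Bounded K s G = rk (G ∪ K) ≤ s + rk K

  ContractionCover : Subset n → ℕ → Subset n → ℕ → Set
  ContractionCover K s F c = ∃[ Gs ] (length Gs ≤ c × All (Bounded K s) Gs × Covers Gs F)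

  weaken-cover : ∀ {K s F c c′} → c ≤ c′ → ContractionCover K s F c → ContractionCover K s F c′
  weaken-cover c≤c′ (Gs , len , bounded , covers) = Gs , ≤-trans len c≤c′ , bounded , covers

  B-independent : ∀ {X} → X ⊆ B → rk X ≡ ∣ X ∣
  B-independent = independent-⊆ (proj₁ B-basis)

  B-spanning : ∀ {Z} → B ⊆ Z → rk Z ≡ ρ
  B-spanning B⊆Z = ≤-antisym (rk-≤ρ _) (≤-trans (≤-reflexive (sym (proj₂ B-basis))) (r-mono M B⊆Z))

  -- Extend K inside B by the points of B not spanned by F ∪ K′ until
  -- F ∪ K′ spans M.  Each added point raises r(F ∪ K′) by one and r(K′) by
  -- at most one, which gives the skew inequality.
  augment : ∀ F {K} → K ⊆ B →
            ∃[ K′ ] (K ⊆ K′ × K′ ⊆ B × rk K′ + rk (F ∪ K) ≤ rk (F ∪ K′) + rk K × rk (F ∪ K′) ≡ ρ)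
  augment F {K} K⊆B = let (K⊆K′ , K′⊆B , skew) = K′-inv in K′ , K⊆K′ , K′⊆B , skew , spanning
    where
    Admissible : Subset n → Fin n → Set
    Admissible X y = y ∈ B × ¬ Spans (F ∪ X) y

    admissible? : ∀ X y → Dec (Admissible X y)
    admissible? X y = (y ∈? B) ×-dec ¬? (spans? (F ∪ X) y)

    open Greedy Admissible admissible?

    Inv : Subset n → Set
    Inv X = K ⊆ X × X ⊆ B × rk X + rk (F ∪ K) ≤ rk (F ∪ X) + rk K

    preserve : ∀ X y → Inv X → Admissible X y → Inv (X ∪ ⁅ y ⁆)
    preserve X y (K⊆X , X⊆B , skew) (y∈B , y-new) =
      (λ x∈ → p⊆p∪q ⁅ y ⁆ (K⊆X x∈)) , ∪-lub X⊆B (⁅⁆⊆ y∈B) , (begin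
        rk (X ∪ ⁅ y ⁆) + rk (F ∪ K)  ≤⟨ +-monoˡ-≤ (rk (F ∪ K)) (rk-∪⁅⁆ X y) ⟩
        suc (rk X + rk (F ∪ K))      ≤⟨ s≤s skew ⟩
        suc (rk (F ∪ X)) + rk K      ≤⟨ +-monoˡ-≤ (rk K) (≰⇒> y-new) ⟩
        rk ((F ∪ X) ∪ ⁅ y ⁆) + rk K  ≡⟨ cong (λ Z → rk Z + rk K) (∪-assoc F X ⁅ y ⁆) ⟩
        rk (F ∪ (X ∪ ⁅ y ⁆)) + rk K  ∎)
      where open ≤-Reasoning

    K′ : Subset n
    K′ = scan K

    K′-inv : Inv K′
    K′-inv = scan-inv Inv preserve K (⊆-refl , K⊆B , ≤-reflexive (+-comm (rk K) (rk (F ∪ K))))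

    B-spanned : ∀ {y} → y ∈ B → Spans (F ∪ K′) y
    B-spanned {y} y∈B with scan-maximal K y
    ... | inj₁ y∈K′ = spans-member (q⊆p∪q F K′ y∈K′)
    ... | inj₂ (X′ , X′⊆K′ , rejected) =
      spans-mono (∪-mono ⊆-refl X′⊆K′)
                 (decidable-stable (spans? (F ∪ X′) y) (λ y-new → rejected (y∈B , y-new)))

    spanning : rk (F ∪ K′) ≡ ρ
    spanning = ≤-antisym (rk-≤ρ _) (begin
      ρ                  ≡⟨ B-spanning (q⊆p∪q (F ∪ K′) B) ⟨
      rk ((F ∪ K′) ∪ B)  ≤⟨ spans-set (F ∪ K′) B B-spanned ⟩
      rk (F ∪ K′)        ∎)
      where open ≤-Reasoning

  augmented-rank : ∀ F {K K′} → K ⊆ K′ → rk (F ∪ K) ≡ suc a + rk K →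
                   rk K′ + rk (F ∪ K) ≤ rk (F ∪ K′) + rk K → rk (F ∪ K′) ≡ ρ → rk K′ + suc a ≡ ρ
  augmented-rank F {K} {K′} K⊆K′ tight skew spanning = ≤-antisym upper lower
    where
    open ≤-Reasoning
    upper : rk K′ + suc a ≤ ρ
    upper = +-cancelʳ-≤ (rk K) (rk K′ + suc a) ρ (begin
      rk K′ + suc a + rk K    ≡⟨ +-assoc (rk K′) (suc a) (rk K) ⟩
      rk K′ + (suc a + rk K)  ≡⟨ cong (rk K′ +_) tight ⟨
      rk K′ + rk (F ∪ K)      ≤⟨ skew ⟩
      rk (F ∪ K′) + rk K      ≡⟨ cong (_+ rk K) spanning ⟩
      ρ + rk K                ∎)
    lower : ρ ≤ rk K′ + suc a
    lower = +-cancelʳ-≤ (rk K) ρ (rk K′ + suc a) (begin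
      ρ + rk K                ≡⟨ cong (_+ rk K) spanning ⟨
      rk (F ∪ K′) + rk K      ≤⟨ submodular-⊆ (F ∪ K) K′ (∪-mono (p⊆p∪q K) ⊆-refl) (∩-glb (q⊆p∪q F K) K⊆K′) ⟩
      rk (F ∪ K) + rk K′      ≡⟨ cong (_+ rk K′) tight ⟩
      suc a + rk K + rk K′    ≡⟨ xy∙z≈zx∙y (suc a) (rk K) (rk K′) ⟩
      rk K′ + suc a + rk K    ∎)

  record Growable (K X : Subset n) : Set where
    field
      avoids  : X ⊆ ∁ K
      large   : a ≤ ∣ X ∣
      small   : ∣ X ∣ ≤ b
      uniform : Uniform (suc a) K X

  Saturated : Subset n → Subset n → Set
  Saturated K X = ∀ y → ∃[ A ] (A ∈ˡ subsetsOfSize a X × Spans (A ∪ K) y)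

  grow : ∀ {K X₀} → ρ ≤ rk K + suc a → Growable K X₀ →
         ∃[ X ] (X₀ ⊆ X × Growable K X × (∣ X ∣ < b → Saturated K X))
  grow {K} {X₀} ρ≤ X₀-growable = X , scan-⊇ X₀ , X-growable , saturated
    where
    Free : Subset n → Fin n → Set
    Free X y = y ∉ K × y ∉ X × ∣ X ∣ < b × All (λ A → ¬ Spans (A ∪ K) y) (subsetsOfSize a X)

    free? : ∀ X y → Dec (Free X y)
    free? X y = ¬? (y ∈? K) ×-dec ¬? (y ∈? X) ×-dec (∣ X ∣ <? b) ×-dec
                All.all? (λ A → ¬? (spans? (A ∪ K) y)) (subsetsOfSize a X)

    open Greedy Free free?

    preserve : ∀ X y → Growable K X → Free X y → Growable K (X ∪ ⁅ y ⁆)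
    preserve X y X-growable (y∉K , y∉X , ∣X∣<b , y-free) = record
      { avoids  = ∪-lub avoids (⁅⁆⊆ (x∉p⇒x∈∁p y∉K))
      ; large   = ≤-trans large (∣p∣≤∣p∪q∣ X ⁅ y ⁆)
      ; small   = subst (_≤ b) (sym (∣∪⁅⁆∣ y∉X)) ∣X∣<b
      ; uniform = uniform-insert ρ≤ large uniform
                    (λ A A⊆X ∣A∣ → All.lookup y-free (subsetsOfSize-complete a X A A⊆X ∣A∣))
      }
      where open Growable X-growable

    X : Subset n
    X = scan X₀

    X-growable : Growable K X
    X-growable = scan-inv (Growable K) preserve X₀ X₀-growable

    open Growable X-growable

    a-subset-⊇ : ∀ Y → Y ⊆ X → ∣ Y ∣ ≤ a → ∃[ A ] (A ∈ˡ subsetsOfSize a X × Y ⊆ A)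
    a-subset-⊇ Y Y⊆X ∣Y∣≤a with interpolate Y X a Y⊆X ∣Y∣≤a large
    ... | A , Y⊆A , A⊆X , ∣A∣ = A , subsetsOfSize-complete a X A A⊆X ∣A∣ , Y⊆A

    saturated : ∣ X ∣ < b → Saturated K X
    saturated ∣X∣<b y with y ∈? K | y ∈? X | scan-maximal X₀ y
    ... | yes y∈K | _ | _ with a-subset-⊇ ⊥ ⊥⊆ (subst (_≤ a) (sym (∣⊥∣≡0 n)) z≤n)
    ...   | A , A∈ , _ = A , A∈ , spans-member (q⊆p∪q A K y∈K)
    saturated ∣X∣<b y | no _ | yes y∈X | _
      with a-subset-⊇ ⁅ y ⁆ (⁅⁆⊆ y∈X) (subst (_≤ a) (sym (∣⁅x⁆∣≡1 y)) 1≤a)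
    ...   | A , A∈ , y⊆A = A , A∈ , spans-member (p⊆p∪q K (y⊆A (x∈⁅x⁆ y)))
    saturated ∣X∣<b y | no _ | no y∉X | inj₁ y∈X = ⊥-elim (y∉X y∈X)
    saturated ∣X∣<b y | no y∉K | no y∉X | inj₂ (X′ , X′⊆X , rejected)
      with find (¬All⇒Any¬ (λ A → ¬? (spans? (A ∪ K) y)) (subsetsOfSize a X′) not-all-free)
      where
      not-all-free : ¬ All (λ A → ¬ Spans (A ∪ K) y) (subsetsOfSize a X′)
      not-all-free all-free =
        rejected (y∉K , (λ y∈X′ → y∉X (X′⊆X y∈X′)) , ≤-<-trans (p⊆q⇒∣p∣≤∣q∣ X′⊆X) ∣X∣<b , all-free)
    ... | A , A∈ , not-free with subsetsOfSize-sound a X′ A∈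
    ...   | A⊆X′ , ∣A∣ = A , subsetsOfSize-complete a X A (⊆-trans A⊆X′ X′⊆X) ∣A∣ ,
                         decidable-stable (spans? (A ∪ K) y) not-free

  complement-size : ∀ {K′} → K′ ⊆ B → rk K′ + suc a ≡ ρ → ∣ B ∩ ∁ K′ ∣ ≡ suc a
  complement-size {K′} K′⊆B rank-eq = +-cancelʳ-≡ ∣ K′ ∣ ∣ B ∩ ∁ K′ ∣ (suc a) (begin
    ∣ B ∩ ∁ K′ ∣ + ∣ K′ ∣  ≡⟨ ∣∣-split K′⊆B ⟨
    ∣ B ∣                  ≡⟨ B-independent ⊆-refl ⟨
    rk B                   ≡⟨ B-spanning ⊆-refl ⟩
    ρ                      ≡⟨ rank-eq ⟨
    rk K′ + suc a          ≡⟨ cong (_+ suc a) (B-independent K′⊆B) ⟩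
    ∣ K′ ∣ + suc a         ≡⟨ +-comm ∣ K′ ∣ (suc a) ⟩
    suc a + ∣ K′ ∣         ∎)
    where open ≡-Reasoning

  complement-growable : ∀ {K′} → K′ ⊆ B → rk K′ + suc a ≡ ρ → Growable K′ (B ∩ ∁ K′)
  complement-growable {K′} K′⊆B rank-eq = record
    { avoids  = p∩q⊆q B (∁ K′)
    ; large   = subst (a ≤_) (sym ∣S∣) (n≤1+n a)
    ; small   = subst (_≤ b) (sym ∣S∣) a<b
    ; uniform = S-uniform
    }
    where
    ∣S∣ = complement-size K′⊆B rank-eq
    S-uniform : Uniform (suc a) K′ (B ∩ ∁ K′)
    S-uniform Y Y⊆S = begin
      rk (Y ∪ K′)              ≡⟨ B-independent (∪-lub (⊆-trans Y⊆S (p∩q⊆p B (∁ K′))) K′⊆B) ⟩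
      ∣ Y ∪ K′ ∣               ≡⟨ ∣∪∣-disjoint Y K′ (⊆-trans Y⊆S (p∩q⊆q B (∁ K′))) ⟩
      ∣ Y ∣ + ∣ K′ ∣           ≡⟨ +-comm ∣ Y ∣ ∣ K′ ∣ ⟩
      ∣ K′ ∣ + ∣ Y ∣           ≡⟨ cong₂ _+_ (B-independent K′⊆B)
                                      (m≥n⇒m⊓n≡n (subst (∣ Y ∣ ≤_) ∣S∣ (p⊆q⇒∣p∣≤∣q∣ Y⊆S))) ⟨
      rk K′ + suc a ⊓ ∣ Y ∣    ∎
      where open ≡-Reasoning

  uniform-minor : ∀ {K X} → X ⊆ ∁ K → ∣ X ∣ ≡ b → Uniform (suc a) K X → ∣ X ∩ B ∣ ≡ suc a →
                  BasisUniformMinor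
  uniform-minor {K} {X} X⊆∁K ∣X∣≡b X-uniform ∣X∩B∣ =
    K , L , (K#L , ∣G∣ , λ Y Y⊆G → minor-rank Y (⊆-trans Y⊆G G⊆X)) ,
    (p∩q⊆p G B , trans basis-rank (sym ∣G∩B∣) , trans basis-rank (sym ground-rank))
    where
    L = ∁ (X ∪ K)
    G = minorGround K L

    G≡X : G ≡ X
    G≡X = ⊆-antisym G⊆X′ X⊆G
      where
      G⊆X′ : G ⊆ X
      G⊆X′ {x} x∈G with x∈p∪q⁻ X K (x∉∁p⇒x∈p (λ x∈L → x∈∁p⇒x∉p x∈G (q⊆p∪q K L x∈L)))
      ... | inj₁ x∈X = x∈X
      ... | inj₂ x∈K = ⊥-elim (x∈∁p⇒x∉p x∈G (p⊆p∪q L x∈K))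
      X⊆G : X ⊆ G
      X⊆G x∈X = x∉p⇒x∈∁p (∉-∪ (x∈∁p⇒x∉p (X⊆∁K x∈X)) (x∈p⇒x∉∁p (p⊆p∪q K x∈X)))

    G⊆X : G ⊆ X
    G⊆X = ⊆-reflexive G≡X

    K#L : Disjoint K L
    K#L = Empty-unique (λ (x , x∈K∩L) →
      x∈∁p⇒x∉p (p∩q⊆q K L x∈K∩L) (q⊆p∪q X K (p∩q⊆p K L x∈K∩L)))

    ∣G∣ : ∣ G ∣ ≡ b
    ∣G∣ = trans (cong ∣_∣ G≡X) ∣X∣≡b

    ∣G∩B∣ : ∣ G ∩ B ∣ ≡ suc a
    ∣G∩B∣ = trans (cong (λ Z → ∣ Z ∩ B ∣) G≡X) ∣X∩B∣

    minor-rank : ∀ Y → Y ⊆ X → minorRank M K Y ≡ suc a ⊓ ∣ Y ∣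
    minor-rank Y Y⊆X = trans (cong (_∸ rk K) (X-uniform Y Y⊆X)) (m+n∸m≡n (rk K) (suc a ⊓ ∣ Y ∣))

    basis-rank : minorRank M K (G ∩ B) ≡ suc a
    basis-rank = trans (minor-rank (G ∩ B) (⊆-trans (p∩q⊆p G B) G⊆X))
                       (trans (cong (suc a ⊓_) ∣G∩B∣) (⊓-idem (suc a)))

    ground-rank : minorRank M K G ≡ suc a
    ground-rank = trans (minor-rank G G⊆X) (trans (cong (suc a ⊓_) ∣G∣) (m≤n⇒m⊓n≡m a<b))

  closure-cover : ∀ F {K K′ X} → K ⊆ K′ → rk K′ + rk (F ∪ K) ≤ rk (F ∪ K′) + rk K →
                  Saturated K′ X → ContractionCover K a F (∣ X ∣ C a)
  closure-cover F {K} {K′} {X} K⊆K′ skew saturated =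
    map piece As , ≤-reflexive (trans (length-map piece As) (length-subsetsOfSize a X)) ,
    map⁺ (All.tabulate (λ A∈ → piece-bounded _ (proj₂ (subsetsOfSize-sound a X A∈)))) , covers
    where
    As = subsetsOfSize a X

    piece : Subset n → Subset n
    piece A = F ∩ closure (A ∪ K′)

    covers : Covers (map piece As) F
    covers {y} y∈F with saturated y
    ... | A , A∈ , A∪K′-spans = piece A , ∈-map⁺ piece A∈ , x∈p∩q⁺ (y∈F , ∈closure⁺ A∪K′-spans)

    piece-bounded : ∀ A → ∣ A ∣ ≡ a → Bounded K a (piece A)
    piece-bounded A ∣A∣ = +-cancelˡ-≤ (rk (F ∪ K′)) (rk (H ∪ K)) (a + rk K) (begin
      rk (F ∪ K′) + rk (H ∪ K)   ≤⟨ submodular-⊆ (H ∪ K′) (F ∪ K)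
                                      (∪-lub (λ x∈F → q⊆p∪q (H ∪ K′) (F ∪ K) (p⊆p∪q K x∈F))
                                             (λ x∈K′ → p⊆p∪q (F ∪ K) (q⊆p∪q H K′ x∈K′)))
                                      (∩-glb (∪-mono ⊆-refl K⊆K′) (∪-mono (p∩q⊆p F _) ⊆-refl)) ⟩
      rk (H ∪ K′) + rk (F ∪ K)   ≤⟨ +-monoˡ-≤ (rk (F ∪ K)) H∪K′-bounded ⟩
      a + rk K′ + rk (F ∪ K)     ≡⟨ +-assoc a (rk K′) (rk (F ∪ K)) ⟩
      a + (rk K′ + rk (F ∪ K))   ≤⟨ +-monoʳ-≤ a skew ⟩
      a + (rk (F ∪ K′) + rk K)   ≡⟨ x∙yz≈y∙xz a (rk (F ∪ K′)) (rk K) ⟩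
      rk (F ∪ K′) + (a + rk K)   ∎)
      where
      open ≤-Reasoning
      H = piece A
      H∪K′-bounded : rk (H ∪ K′) ≤ a + rk K′
      H∪K′-bounded = begin
        rk (H ∪ K′)         ≤⟨ r-mono M (∪-lub (q⊆p∪q (A ∪ K′) H) (λ x∈ → p⊆p∪q H (q⊆p∪q A K′ x∈))) ⟩
        rk ((A ∪ K′) ∪ H)   ≤⟨ spans-set (A ∪ K′) H (λ y∈H → ∈closure⁻ (p∩q⊆q F _ y∈H)) ⟩
        rk (A ∪ K′)         ≤⟨ subadditive A K′ ⟩
        rk A + rk K′        ≤⟨ +-monoˡ-≤ (rk K′) (subst (rk A ≤_) ∣A∣ (r-bnd M A)) ⟩
        a + rk K′           ∎

  -- Augment K to K′ ⊆ B with F ∪ K′ spanning, so that S = B − K′ has a + 1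
  -- points, and grow S to X, uniform of rank a + 1 over K′.  If X reaches
  -- b points it yields the minor; otherwise X is saturated and the closures
  -- of its a-subsets refine F into at most (b - 1) C a pieces.
  tight-refinement : ∀ F {K} → K ⊆ B → rk (F ∪ K) ≡ suc a + rk K →
                     BasisUniformMinor ⊎ ContractionCover K a F D
  tight-refinement F {K} K⊆B tight with augment F K⊆B
  ... | K′ , K⊆K′ , K′⊆B , skew , spanning
    with grow (≤-reflexive (sym rank-eq)) (complement-growable K′⊆B rank-eq)
    where rank-eq = augmented-rank F K⊆K′ tight skew spanning
  ... | X , S⊆X , X-growable , saturated with m≤n⇒m<n∨m≡n (Growable.small X-growable)
  ...   | inj₁ ∣X∣<b = inj₂ (weaken-cover (C-monoˡ a (suc[m]≤n⇒m≤pred[n] ∣X∣<b))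
                                          (closure-cover F {X = X} K⊆K′ skew (saturated ∣X∣<b)))
  ...   | inj₂ ∣X∣≡b = inj₁ (uniform-minor avoids ∣X∣≡b uniform ∣X∩B∣)
    where
    open Growable X-growable
    X∩B≡S : X ∩ B ≡ B ∩ ∁ K′
    X∩B≡S = ⊆-antisym (λ x∈ → x∈p∩q⁺ (p∩q⊆q X B x∈ , avoids (p∩q⊆p X B x∈)))
                      (∩-glb S⊆X (p∩q⊆p B (∁ K′)))
    ∣X∩B∣ : ∣ X ∩ B ∣ ≡ suc a
    ∣X∩B∣ = trans (cong ∣_∣ X∩B≡S) (complement-size K′⊆B (augmented-rank F K⊆K′ tight skew spanning))

  local-refinement : ∀ F {K} → K ⊆ B → Bounded K (suc a) F →
                     BasisUniformMinor ⊎ ContractionCover K a F D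
  local-refinement F {K} K⊆B F-bounded with rk (F ∪ K) ≤? a + rk K
  ... | yes F-low = inj₂ (F ∷ [] , D-pos , F-low ∷ [] , λ y∈F → F , here refl , y∈F)
  ... | no  F-high = tight-refinement F K⊆B (≤-antisym F-bounded (≰⇒> F-high))

  refine-all : ∀ {K} → K ⊆ B → (Gs : List (Subset n)) → All (Bounded K (suc a)) Gs →
               BasisUniformMinor ⊎
               ∃[ Hs ] (length Hs ≤ length Gs * D × All (Bounded K a) Hs × All (Covers Hs) Gs)
  refine-all K⊆B [] [] = inj₂ ([] , z≤n , [] , [])
  refine-all K⊆B (G ∷ Gs) (G-bounded ∷ Gs-bounded)
    with local-refinement G K⊆B G-bounded | refine-all K⊆B Gs Gs-bounded
  ... | inj₁ minor | _ = inj₁ minor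
  ... | inj₂ _     | inj₁ minor = inj₁ minor
  ... | inj₂ (Hs₁ , len₁ , bounded₁ , covers₁) | inj₂ (Hs₂ , len₂ , bounded₂ , covers₂) =
    inj₂ (Hs₁ ++ Hs₂ , ≤-trans (≤-reflexive (length-++ Hs₁)) (+-mono-≤ len₁ len₂) ,
          ++⁺ bounded₁ bounded₂ , covers-++ˡ Hs₂ covers₁ ∷ All.map (covers-++ʳ Hs₁) covers₂)

  refine : ∀ {K F c} → K ⊆ B → ContractionCover K (suc a) F c →
           BasisUniformMinor ⊎ ContractionCover K a F (c * D)
  refine K⊆B (Gs , len , bounded , covers) with refine-all K⊆B Gs bounded
  ... | inj₁ minor = inj₁ minor
  ... | inj₂ (Hs , len′ , bounded′ , refines) =
    inj₂ (Hs , ≤-trans len′ (*-monoˡ-≤ D len) , bounded′ , covers′)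
    where
    covers′ : Covers Hs _
    covers′ y∈F with covers y∈F
    ... | G , G∈ , y∈G = All.lookup refines G∈ y∈G

  basis-escape : ∀ {K} → rk K < ρ → ∃[ e ] (e ∈ B × ¬ Spans K e)
  basis-escape {K} rk<ρ with any? (λ e → (e ∈? B) ×-dec ¬? (spans? K e))
  ... | yes escape = escape
  ... | no  none   = ⊥-elim (<⇒≱ rk<ρ (begin
    ρ           ≡⟨ B-spanning (q⊆p∪q K B) ⟨
    rk (K ∪ B)  ≤⟨ spans-set K B (λ {e} e∈B →
                     decidable-stable (spans? K e) (λ e-free → none (e , e∈B , e-free))) ⟩
    rk K        ∎))
    where open ≤-Reasoning

  bounded-uncontract : ∀ {K e G} → Bounded (K ∪ ⁅ e ⁆) a G → Bounded K (suc a) G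
  bounded-uncontract {K} {e} {G} G-bounded = begin
    rk (G ∪ K)            ≤⟨ r-mono M (∪-mono ⊆-refl (p⊆p∪q ⁅ e ⁆)) ⟩
    rk (G ∪ (K ∪ ⁅ e ⁆))  ≤⟨ G-bounded ⟩
    a + rk (K ∪ ⁅ e ⁆)    ≤⟨ +-monoʳ-≤ a (rk-∪⁅⁆ K e) ⟩
    a + suc (rk K)        ≡⟨ +-suc a (rk K) ⟩
    suc a + rk K          ∎
    where open ≤-Reasoning

  -- In the step, K is enlarged by a basis element e
  -- outside cl(K) and the cover for K ∪ e is refined.
  layered-cover : ∀ j {K} → K ⊆ B → ρ ≤ a + j + rk K →
                  BasisUniformMinor ⊎ ContractionCover K a ⊤ (D ^ j)
  layered-cover j {K} K⊆B ρ≤ with ρ ≤? a + rk K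
  ... | yes ρ-low = inj₂ (⊤ ∷ [] , m^n>0 D {{>-nonZero D-pos}} j , ≤-trans (rk-≤ρ _) ρ-low ∷ [] ,
                          λ _ → ⊤ , here refl , ∈⊤)
  layered-cover zero {K} K⊆B ρ≤ | no ρ-high =
    ⊥-elim (ρ-high (subst (λ t → ρ ≤ t + rk K) (+-identityʳ a) ρ≤))
  layered-cover (suc j) {K} K⊆B ρ≤ | no ρ-high
    with basis-escape (≤-<-trans (m≤n+m (rk K) a) (≰⇒> ρ-high))
  ... | e , e∈B , e-free with layered-cover j (∪-lub K⊆B (⁅⁆⊆ e∈B)) ρ≤′
    where
    ρ≤′ : ρ ≤ a + j + rk (K ∪ ⁅ e ⁆)
    ρ≤′ = begin
      ρ                       ≤⟨ ρ≤ ⟩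
      a + suc j + rk K        ≡⟨ cong (_+ rk K) (+-suc a j) ⟩
      suc (a + j + rk K)      ≡⟨ +-suc (a + j) (rk K) ⟨
      a + j + suc (rk K)      ≤⟨ +-monoʳ-≤ (a + j) (≰⇒> e-free) ⟩
      a + j + rk (K ∪ ⁅ e ⁆)  ∎
      where open ≤-Reasoning
  ...   | inj₁ minor = inj₁ minor
  ...   | inj₂ (Gs , len , bounded , covers)
    with refine K⊆B (Gs , len , All.map bounded-uncontract bounded , covers)
  ...     | inj₁ minor = inj₁ minor
  ...     | inj₂ cover = inj₂ (weaken-cover (≤-reflexive (*-comm (D ^ j) D)) cover)

  -- The induction starts from K = ∅.
  room-at-start : a < ρ → ρ ≤ a + (ρ ∸ a) + rk ⊥
  room-at-start a<ρ = ≤-reflexive (sym (begin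
    a + (ρ ∸ a) + rk ⊥  ≡⟨ cong (a + (ρ ∸ a) +_) rk-⊥ ⟩
    a + (ρ ∸ a) + 0     ≡⟨ +-identityʳ (a + (ρ ∸ a)) ⟩
    a + (ρ ∸ a)         ≡⟨ m+[n∸m]≡n (<⇒≤ a<ρ) ⟩
    ρ                   ∎))
    where open ≡-Reasoning

  cover-of-M : ∀ {c} → ContractionCover ⊥ a ⊤ c → ∃[ k ] (k ≤ c × HasCover M a k)
  cover-of-M (Gs , len , bounded , covers) =
    length Gs , len , Gs , refl , All.map rank-≤a bounded , λ e → covers ∈⊤
    where
    rank-≤a : ∀ {G} → Bounded ⊥ a G → rk G ≤ a
    rank-≤a {G} G-bounded = ≤-trans (r-mono M (p⊆p∪q ⊥))
      (≤-trans G-bounded (≤-reflexive (trans (cong (a +_) rk-⊥) (+-identityʳ a))))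

  no-small-cover : a < ρ → ∀ {t} → IsTau M a t → (b C a) ^ (ρ ∸ a) ≤ t →
                   ¬ ContractionCover ⊥ a ⊤ (D ^ (ρ ∸ a))
  no-small-cover a<ρ {t} (_ , τ-least) τ-bound cover with cover-of-M cover
  ... | k , k≤ , a-cover = <⇒≱ D^<bCa^ (begin
    (b C a) ^ (ρ ∸ a)  ≤⟨ τ-bound ⟩
    t                  ≤⟨ τ-least k a-cover ⟩
    k                  ≤⟨ k≤ ⟩
    D ^ (ρ ∸ a)        ∎)
    where
    open ≤-Reasoning
    D^<bCa^ : D ^ (ρ ∸ a) < (b C a) ^ (ρ ∸ a)
    D^<bCa^ = ^-monoˡ-< (ρ ∸ a) {{>-nonZero (m<n⇒0<n∸m a<ρ)}} (C-pred< 1≤a a<b)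

lemma2p1 : (a b : ℕ) → 1 ≤ a → a < b →
    ∀ {n} (M : Matroid n) (B : Subset n) → IsBasis M B → a < rankM M →
    (t : ℕ) → IsTau M a t → (b C a) ^ (rankM M ∸ a) ≤ t →
    ∃[ K ] ∃[ L ] (IsUniformMinor M K L (suc a) b ×
                   IsMinorBasis M K L (minorGround K L ∩ B))
lemma2p1 a b 1≤a a<b M B B-basis a<ρ t τ τ-bound =
  [ (λ minor → minor) , (λ cover → ⊥-elim (no-small-cover a<ρ τ τ-bound cover)) ]′
    (layered-cover (rankM M ∸ a) ⊥⊆ (room-at-start a<ρ))
  where open Covering M B B-basis a b 1≤a a<b
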